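{- Let $U=\{M_1,\dots,M_m\}$ be a set of real $n\times n$ matrices such that no permutation is an a-Monge permutation for all matrices in $U$. Then there is a subset $U'\subseteq U$ with $|U'|\le 3$ such that no permutation is an a-Monge permutation for all matrices in $U'$.
   Context: A square real matrix $N$ indexed by $\{0,\dots,n-1\}$ is a-Monge if $N(i,s)+N(r,j)\le N(i,j)+N(r,s)$ for all $i<r$ and $j<s$. A permutation $\pi$ of $\{0,\dots,n-1\}$ is an a-Monge permutation for a square matrix $M$ if the matrix $N(i,j)=M(\pi(i),\pi(j))$ (rows and columns permuted simultaneously by the same permutation) is a-Monge. -}

module Defs where

open import Level using (0ℓ)
open import Data.Nat using (ℕ)
open import Data.Fin using (Fin) renaming (_<_ to _<ᶠ_)
open import Data.Fin.Permutation using (Permutation′; _⟨$⟩ʳ_)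
open import Data.Product using (Σ; ∃; _×_)
open import Relation.Binary.PropositionalEquality using (_≡_)
open import Relation.Binary.Structures using (IsTotalOrder)
open import Algebra.Structures using (IsCommutativeRing)
open import Relation.Nullary using (¬_)

-- An axiomatisation of the real numbers: a Dedekind-complete ordered field
-- (any two models are isomorphic), with propositional equality.
record RealNumbers : Set₁ where
  infixl 6 _+_
  infixl 7 _*_
  infix 4 _≤_
  field
    ℝ : Set
    0ℝ 1ℝ : ℝ
    _+_ _*_ : ℝ → ℝ → ℝ
    -_ : ℝ → ℝ
    _≤_ : ℝ → ℝ → Set
    isCommutativeRing : IsCommutativeRing _≡_ _+_ _*_ -_ 0ℝ 1ℝ
    0≢1 : ¬ (0ℝ ≡ 1ℝ)
    inverse : ∀ x → ¬ (x ≡ 0ℝ) → Σ ℝ (λ y → x * y ≡ 1ℝ)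
    isTotalOrder : IsTotalOrder _≡_ _≤_
    +-mono-≤ : ∀ {x y} z → x ≤ y → x + z ≤ y + z
    *-nonneg : ∀ {x y} → 0ℝ ≤ x → 0ℝ ≤ y → 0ℝ ≤ x * y
    lub : (P : ℝ → Set) → ∃ P → ∃ (λ b → ∀ x → P x → x ≤ b) →
          ∃ (λ s → (∀ x → P x → x ≤ s) × (∀ b → (∀ x → P x → x ≤ b) → s ≤ b))

module _ (R : RealNumbers) where
  open RealNumbers R

  Matrix : ℕ → Set
  Matrix n = Fin n → Fin n → ℝ

  IsAMonge : ∀ {n} → Matrix n → Set
  IsAMonge N = ∀ i r j s → i <ᶠ r → j <ᶠ s → N i s + N r j ≤ N i j + N r s

  permuteMatrix : ∀ {n} → Permutation′ n → Matrix n → Matrix n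
  permuteMatrix π M i j = M (π ⟨$⟩ʳ i) (π ⟨$⟩ʳ j)

  IsAMongePermutation : ∀ {n} → Permutation′ n → Matrix n → Set
  IsAMongePermutation π M = IsAMonge (permuteMatrix π M)

{-# OPTIONS --safe #-}
-- For a matrix N and a pair (x , y) let the profile be ψ a = S a y - S a x, where S = N + Nᵀ.
-- If N is a-Monge along an ordering L whose first and last elements are x and y, then ψ is monotone
-- along L, and conversely N is a-Monge along every ordering that sorts ψ.  Suppose any three of the
-- matrices have a common a-Monge permutation.  If the profiles θ β, taken from an a-Monge ordering
-- of M β, are all constant, every permutation is a-Monge for every M k.  Otherwise fix β with θ β
-- nonconstant.  An ordering common to M β and M k gives a profile χ k of M k, oriented so that it is
-- comonotone with θ β.  Along an ordering common to M β, M j and M k, all of θ β, χ j and χ k are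
-- monotone, and one running against the nonconstant θ β is constant; so χ j and χ k are comonotone.
-- Sorting by Σ χ k then sorts every χ k simultaneously, which gives a common a-Monge permutation.
-- The search for a bad triple is constructive thanks to the weak excluded middle, which follows from
-- the least-upper-bound axiom.

module Submission where

open import Defs
open import Level using (0ℓ)
open import Algebra.Bundles using (CommutativeRing)
import Algebra.Properties.Ring as RingProperties
import Algebra.Properties.CommutativeSemigroup as CommutativeSemigroupProperties
import Algebra.Definitions.RawMonoid as RawMonoidDefinitions
import Algebra.Solver.CommutativeMonoid as CommutativeMonoidSolver
open import Data.Bool using (Bool; true; false; not)
open import Data.Empty using (⊥-elim)
open import Data.Fin using (Fin; zero; suc; fromℕ; punchIn) renaming (_≤_ to _≤ᶠ_)
import Data.Fin.Properties as Fin
open import Data.Fin.Permutation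
  using (Permutation′; _⟨$⟩ʳ_; _⟨$⟩ˡ_; inverseʳ; inverseˡ; id; insert; insert-punchIn)
open import Data.Fin.Subset using (Subset; _∈_; _∪_; ⁅_⁆; ∣_∣; inside; outside)
open import Data.Fin.Subset.Properties using (x∈⁅x⁆; x∈p∪q⁺; ∣⁅x⁆∣≡1)
open import Data.Nat as ℕ using (ℕ; z≤n; s≤s)
import Data.Nat.Properties as ℕ
open import Data.Product using (Σ; Σ-syntax; ∃; _×_; _,_; proj₁; proj₂; curry; uncurry; swap)
open import Data.Sum as Sum using (_⊎_; inj₁; inj₂; [_,_]; map₂; fromInj₂)
open import Data.Vec using ([]; _∷_)
open import Function using (_∘_; _⇔_; mk⇔; Equivalence)
open import Relation.Binary.Bundles using (TotalOrder; TotalPreorder)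
open import Relation.Binary.Structures using (IsTotalOrder)
open import Relation.Binary.PropositionalEquality using (_≡_; refl; sym; trans; cong; cong₂; subst; subst₂)
open import Relation.Nullary using (¬_; Dec; yes; no; does; contradiction)

module Comonotonicity {c ℓ₁ ℓ₂} (O : TotalOrder c ℓ₁ ℓ₂) where
  open TotalOrder O

  module _ {a} {A : Set a} where
    Comonotone Antimonotone : (A → Carrier) → (A → Carrier) → Set _
    Comonotone f g = ∀ x y → (f x ≤ f y × g x ≤ g y) ⊎ (f y ≤ f x × g y ≤ g x)
    Antimonotone f g = ∀ x y → (f x ≤ f y × g y ≤ g x) ⊎ (f y ≤ f x × g x ≤ g y)

    Constant NonConstant : (A → Carrier) → Set _
    Constant f = ∀ x y → f x ≈ f y
    NonConstant f = ∃ λ x → ∃ λ y → ¬ f x ≈ f y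

    comonotone-sym : ∀ {f g} → Comonotone f g → Comonotone g f
    comonotone-sym co x y = Sum.map swap swap (co x y)

    constant⇒comonotone : ∀ {f g} → Constant f → Comonotone f g
    constant⇒comonotone {f} {g} const x y with total (g x) (g y)
    ... | inj₁ gx≤gy = inj₁ (reflexive (const x y) , gx≤gy)
    ... | inj₂ gy≤gx = inj₂ (reflexive (const y x) , gy≤gx)

    comonotone∧antimonotone⇒≈ : ∀ {f g} → Comonotone f g → Antimonotone f g →
                                ∀ x y → f x ≈ f y ⊎ g x ≈ g y
    comonotone∧antimonotone⇒≈ co anti x y with co x y | anti x y
    ... | inj₁ (_ , gx≤gy) | inj₁ (_ , gy≤gx) = inj₂ (antisym gx≤gy gy≤gx)
    ... | inj₁ (fx≤fy , _) | inj₂ (fy≤fx , _) = inj₁ (antisym fx≤fy fy≤fx)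
    ... | inj₂ (fy≤fx , _) | inj₁ (fx≤fy , _) = inj₁ (antisym fx≤fy fy≤fx)
    ... | inj₂ (_ , gy≤gx) | inj₂ (_ , gx≤gy) = inj₂ (antisym gx≤gy gy≤gx)

    comonotone∧antimonotone⇒constant : ∀ {f g} → NonConstant f → Comonotone f g → Antimonotone f g →
                                       Constant g
    comonotone∧antimonotone⇒constant {f} {g} (a , b , fa≉fb) co anti x y =
      Eq.trans (≈ga x) (Eq.sym (≈ga y))
      where
      split : ∀ x y → f x ≈ f y ⊎ g x ≈ g y
      split = comonotone∧antimonotone⇒≈ co anti
      ga≈gb : g a ≈ g b
      ga≈gb = fromInj₂ (λ fa≈fb → contradiction fa≈fb fa≉fb) (split a b)
      ≈ga : ∀ z → g z ≈ g a
      ≈ga z with split z a | split z b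
      ... | inj₂ gz≈ga | _ = gz≈ga
      ... | inj₁ _ | inj₂ gz≈gb = Eq.trans gz≈gb (Eq.sym ga≈gb)
      ... | inj₁ fz≈fa | inj₁ fz≈fb = contradiction (Eq.trans (Eq.sym fz≈fa) fz≈fb) fa≉fb

  module _ {n : ℕ} where
    MonotoneAlong : Bool → Permutation′ n → (Fin n → Carrier) → Set _
    MonotoneAlong true  L f = ∀ {a b} → L ⟨$⟩ˡ a ≤ᶠ L ⟨$⟩ˡ b → f a ≤ f b
    MonotoneAlong false L f = ∀ {a b} → L ⟨$⟩ˡ a ≤ᶠ L ⟨$⟩ˡ b → f b ≤ f a

    monotoneAlong⇒comonotone : ∀ {d L f g} → MonotoneAlong d L f → MonotoneAlong d L g → Comonotone f g
    monotoneAlong⇒comonotone {true} {L} mf mg a b with Fin.≤-total (L ⟨$⟩ˡ a) (L ⟨$⟩ˡ b)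
    ... | inj₁ a≤b = inj₁ (mf a≤b , mg a≤b)
    ... | inj₂ b≤a = inj₂ (mf b≤a , mg b≤a)
    monotoneAlong⇒comonotone {false} {L} mf mg a b with Fin.≤-total (L ⟨$⟩ˡ a) (L ⟨$⟩ˡ b)
    ... | inj₁ a≤b = inj₂ (mf a≤b , mg a≤b)
    ... | inj₂ b≤a = inj₁ (mf b≤a , mg b≤a)

    monotoneAlong-opposite⇒antimonotone : ∀ {d L f g} → MonotoneAlong d L f → MonotoneAlong (not d) L g →
                                          Antimonotone f g
    monotoneAlong-opposite⇒antimonotone {true} {L} mf mg a b with Fin.≤-total (L ⟨$⟩ˡ a) (L ⟨$⟩ˡ b)
    ... | inj₁ a≤b = inj₁ (mf a≤b , mg a≤b)
    ... | inj₂ b≤a = inj₂ (mf b≤a , mg b≤a)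
    monotoneAlong-opposite⇒antimonotone {false} {L} mf mg a b with Fin.≤-total (L ⟨$⟩ˡ a) (L ⟨$⟩ˡ b)
    ... | inj₁ a≤b = inj₂ (mf a≤b , mg a≤b)
    ... | inj₂ b≤a = inj₁ (mf b≤a , mg b≤a)

    aligned-or-constant : ∀ {d e L f g} → NonConstant f → Comonotone f g →
                          MonotoneAlong d L f → MonotoneAlong e L g → MonotoneAlong d L g ⊎ Constant g
    aligned-or-constant {true}  {true}  _  _  _  mg = inj₁ mg
    aligned-or-constant {false} {false} _  _  _  mg = inj₁ mg
    aligned-or-constant {true}  {false} {L} nc co mf mg =
      inj₂ (comonotone∧antimonotone⇒constant nc co (monotoneAlong-opposite⇒antimonotone {true} {L} mf mg))
    aligned-or-constant {false} {true}  {L} nc co mf mg =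
      inj₂ (comonotone∧antimonotone⇒constant nc co (monotoneAlong-opposite⇒antimonotone {false} {L} mf mg))

    aligned-or-constant⇒comonotone : ∀ {d L f g} → MonotoneAlong d L f ⊎ Constant f →
                                     MonotoneAlong d L g ⊎ Constant g → Comonotone f g
    aligned-or-constant⇒comonotone {d} {L} (inj₁ mf) (inj₁ mg) = monotoneAlong⇒comonotone {d} {L} mf mg
    aligned-or-constant⇒comonotone (inj₂ cf) _         = constant⇒comonotone cf
    aligned-or-constant⇒comonotone (inj₁ _)  (inj₂ cg) = comonotone-sym (constant⇒comonotone cg)

module Sorting {c ℓ₁ ℓ₂} (O : TotalPreorder c ℓ₁ ℓ₂) where
  open TotalPreorder O using (Carrier; total) renaming (_≲_ to _≤_; refl to ≤-refl; trans to ≤-trans)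

  minimum : ∀ {n} (f : Fin (ℕ.suc n) → Carrier) → Σ[ x ∈ Fin (ℕ.suc n) ] (∀ y → f x ≤ f y)
  minimum {ℕ.zero} f = zero , λ { zero → ≤-refl }
  minimum {ℕ.suc n} f with minimum (f ∘ suc)
  ... | x , fx≤ with total (f zero) (f (suc x))
  ...   | inj₁ f0≤fx = zero , λ { zero → ≤-refl ; (suc y) → ≤-trans f0≤fx (fx≤ y) }
  ...   | inj₂ fx≤f0 = suc x , λ { zero → fx≤f0 ; (suc y) → fx≤ y }

  sortingPermutation : ∀ {n} (f : Fin n → Carrier) →
                       Σ[ π ∈ Permutation′ n ] (∀ {i j} → i ≤ᶠ j → f (π ⟨$⟩ʳ i) ≤ f (π ⟨$⟩ʳ j))
  sortingPermutation {ℕ.zero} f = id , λ { {()} }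
  sortingPermutation {ℕ.suc n} f with minimum f
  ... | x , min with sortingPermutation (f ∘ punchIn x)
  ...   | π , sorted = insert zero x π , sorted′
    where
    sorted′ : ∀ {i j} → i ≤ᶠ j → f (insert zero x π ⟨$⟩ʳ i) ≤ f (insert zero x π ⟨$⟩ʳ j)
    sorted′ {zero}  _ = min _
    sorted′ {suc i} {suc j} (s≤s i≤j) =
      subst₂ _≤_ (cong f (sym (insert-punchIn zero x π i))) (cong f (sym (insert-punchIn zero x π j)))
        (sorted i≤j)

¬¬-∀ : ∀ {n p} {P : Fin n → Set p} → (∀ i → ¬ ¬ P i) → ¬ ¬ (∀ i → P i)
¬¬-∀ {ℕ.zero}  _ k = k λ ()
¬¬-∀ {ℕ.suc n} h k = h zero λ p₀ → ¬¬-∀ (h ∘ suc) λ ps → k (Fin.∀-cons p₀ ps)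

∀⊎⇒⊎∀ : ∀ {n a b} {A : Set a} {B : Fin n → Set b} → (∀ i → A ⊎ B i) → A ⊎ (∀ i → B i)
∀⊎⇒⊎∀ {ℕ.zero}  _ = inj₂ λ ()
∀⊎⇒⊎∀ {ℕ.suc n} h = [ inj₁ , (λ b₀ → map₂ (Fin.∀-cons b₀) (∀⊎⇒⊎∀ (h ∘ suc))) ] (h zero)

∣p∪q∣≤∣p∣+∣q∣ : ∀ {n} (p q : Subset n) → ∣ p ∪ q ∣ ℕ.≤ ∣ p ∣ ℕ.+ ∣ q ∣
∣p∪q∣≤∣p∣+∣q∣ []            []            = z≤n
∣p∪q∣≤∣p∣+∣q∣ (outside ∷ p) (outside ∷ q) = ∣p∪q∣≤∣p∣+∣q∣ p q
∣p∪q∣≤∣p∣+∣q∣ (outside ∷ p) (inside ∷ q)  =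
  ℕ.≤-trans (s≤s (∣p∪q∣≤∣p∣+∣q∣ p q)) (ℕ.≤-reflexive (sym (ℕ.+-suc ∣ p ∣ ∣ q ∣)))
∣p∪q∣≤∣p∣+∣q∣ (inside ∷ p)  (outside ∷ q) = s≤s (∣p∪q∣≤∣p∣+∣q∣ p q)
∣p∪q∣≤∣p∣+∣q∣ (inside ∷ p)  (inside ∷ q)  =
  s≤s (ℕ.≤-trans (∣p∪q∣≤∣p∣+∣q∣ p q) (ℕ.+-monoʳ-≤ ∣ p ∣ (ℕ.n≤1+n ∣ q ∣)))

∣⁅i⁆∪⁅j⁆∪⁅k⁆∣≤3 : ∀ {n} (i j k : Fin n) → ∣ ⁅ i ⁆ ∪ ⁅ j ⁆ ∪ ⁅ k ⁆ ∣ ℕ.≤ 3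
∣⁅i⁆∪⁅j⁆∪⁅k⁆∣≤3 i j k = ℕ.≤-trans (∣p∪q∣≤∣p∣+∣q∣ ⁅ i ⁆ (⁅ j ⁆ ∪ ⁅ k ⁆))
  (ℕ.+-mono-≤ (ℕ.≤-reflexive (∣⁅x⁆∣≡1 i))
    (ℕ.≤-trans (∣p∪q∣≤∣p∣+∣q∣ ⁅ j ⁆ ⁅ k ⁆) (ℕ.≤-reflexive (cong₂ ℕ._+_ (∣⁅x⁆∣≡1 j) (∣⁅x⁆∣≡1 k)))))

module Reals (R : RealNumbers) where
  open RealNumbers R renaming (+-mono-≤ to +-monoˡ-≤)
  open IsTotalOrder isTotalOrder using (total; antisym; reflexive) renaming (refl to ≤-refl; trans to ≤-trans)

  ℝ-ring : CommutativeRing 0ℓ 0ℓ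
  ℝ-ring = record { isCommutativeRing = isCommutativeRing }

  open CommutativeRing ℝ-ring
    using (_-_; +-comm; +-assoc; +-identityˡ; -‿inverseʳ; +-rawMonoid; +-commutativeMonoid)
  open RingProperties (CommutativeRing.ring ℝ-ring)
    using (-1*x≈-x; -‿involutive; \\-leftDividesʳ; //-rightDividesʳ)
  open CommutativeSemigroupProperties (CommutativeRing.+-commutativeSemigroup ℝ-ring) using (interchange)
  open RawMonoidDefinitions +-rawMonoid using (sum)
  open CommutativeMonoidSolver +-commutativeMonoid using (solve; _⊕_; _⊜_)

  ℝ-totalOrder : TotalOrder 0ℓ 0ℓ 0ℓ
  ℝ-totalOrder = record { isTotalOrder = isTotalOrder }

  open Comonotonicity ℝ-totalOrder public
  open Sorting (TotalOrder.totalPreorder ℝ-totalOrder) public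

  +-monoʳ-≤ : ∀ z {x y} → x ≤ y → z + x ≤ z + y
  +-monoʳ-≤ z {x} {y} x≤y = subst₂ _≤_ (+-comm x z) (+-comm y z) (+-monoˡ-≤ z x≤y)

  +-mono-≤ : ∀ {x y u v} → x ≤ y → u ≤ v → x + u ≤ y + v
  +-mono-≤ {y = y} {u} x≤y u≤v = ≤-trans (+-monoˡ-≤ u x≤y) (+-monoʳ-≤ y u≤v)

  +-cancelʳ-≤ : ∀ z {x y} → x + z ≤ y + z → x ≤ y
  +-cancelʳ-≤ z {x} {y} h = subst₂ _≤_ (//-rightDividesʳ z x) (//-rightDividesʳ z y) (+-monoˡ-≤ (- z) h)

  +-cancelˡ-≤ : ∀ z {x y} → z + x ≤ z + y → x ≤ y
  +-cancelˡ-≤ z {x} {y} h = subst₂ _≤_ (\\-leftDividesʳ z x) (\\-leftDividesʳ z y) (+-monoʳ-≤ (- z) h)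

  ≤-by-balance : ∀ {p q x y} → p ≤ q → x + q ≡ y + p → x ≤ y
  ≤-by-balance {q = q} {x} {y} p≤q balance =
    +-cancelʳ-≤ q (subst (_≤ y + q) (sym balance) (+-monoʳ-≤ y p≤q))

  x-y≤u-v⇔x+v≤y+u : ∀ {x y u v} → (x - y ≤ u - v) ⇔ (x + v ≤ y + u)
  x-y≤u-v⇔x+v≤y+u {x} {y} {u} {v} =
    mk⇔ (λ h → subst₂ _≤_ (shift x y v) shift′ (+-monoˡ-≤ (y + v) h))
        (λ h → +-cancelʳ-≤ (y + v) (subst₂ _≤_ (sym (shift x y v)) (sym shift′) h))
    where
    shift : ∀ x y v → (x - y) + (y + v) ≡ x + v
    shift x y v = trans (+-assoc x (- y) (y + v)) (cong (x +_) (\\-leftDividesʳ y v))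
    shift′ : (u - v) + (y + v) ≡ y + u
    shift′ = trans (cong ((u - v) +_) (+-comm y v)) (trans (shift u v y) (+-comm u y))

  sum-mono-≤ : ∀ {m} {f g : Fin m → ℝ} → (∀ j → f j ≤ g j) → sum f ≤ sum g
  sum-mono-≤ {ℕ.zero}  _   = ≤-refl
  sum-mono-≤ {ℕ.suc m} f≤g = +-mono-≤ (f≤g zero) (sum-mono-≤ (f≤g ∘ suc))

  sum-squeeze : ∀ {m} {f g : Fin m → ℝ} → (∀ j → g j ≤ f j) → sum f ≤ sum g → ∀ j → f j ≤ g j
  sum-squeeze {ℕ.suc m} {f} {g} g≤f Σf≤Σg zero =
    +-cancelʳ-≤ (sum (f ∘ suc)) (≤-trans Σf≤Σg (+-monoʳ-≤ (g zero) (sum-mono-≤ (g≤f ∘ suc))))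
  sum-squeeze {ℕ.suc m} {f} {g} g≤f Σf≤Σg (suc j) =
    sum-squeeze (g≤f ∘ suc) (+-cancelˡ-≤ (g zero) (≤-trans (+-monoˡ-≤ (sum (f ∘ suc)) (g≤f zero)) Σf≤Σg)) j

  comonotone-sum-≤⇒≤ : ∀ {m a} {A : Set a} (χ : Fin m → A → ℝ) → (∀ j k → Comonotone (χ j) (χ k)) →
                       ∀ {x y} → sum (λ j → χ j x) ≤ sum (λ j → χ j y) → ∀ k → χ k x ≤ χ k y
  comonotone-sum-≤⇒≤ χ co {x} {y} Σ≤ k =
    [ (λ χkx≤χky → χkx≤χky) , (λ ≥ → sum-squeeze ≥ Σ≤ k) ] (∀⊎⇒⊎∀ (λ j → Sum.map proj₁ proj₂ (co k j x y)))

  0≤1 : 0ℝ ≤ 1ℝ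
  0≤1 with total 0ℝ 1ℝ
  ... | inj₁ 0≤1 = 0≤1
  ... | inj₂ 1≤0 = subst (0ℝ ≤_) (trans (-1*x≈-x (- 1ℝ)) (-‿involutive 1ℝ)) (*-nonneg 0≤-1 0≤-1)
    where
    0≤-1 : 0ℝ ≤ - 1ℝ
    0≤-1 = subst₂ _≤_ (-‿inverseʳ 1ℝ) (+-identityˡ (- 1ℝ)) (+-monoˡ-≤ (- 1ℝ) 1≤0)

  1≰0 : ¬ (1ℝ ≤ 0ℝ)
  1≰0 1≤0 = 0≢1 (antisym 0≤1 1≤0)

  -- The supremum s of {0} ∪ {1 + 1 | P} exists; s ≤ 1 refutes P and 1 ≤ s refutes ¬ P.
  weak-excluded-middle : (P : Set) → Dec (¬ P)
  weak-excluded-middle P = decide (lub Candidate (0ℝ , inj₁ refl) (2ℝ , ≤2))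
    where
    2ℝ : ℝ
    2ℝ = 1ℝ + 1ℝ
    Candidate : ℝ → Set
    Candidate z = z ≡ 0ℝ ⊎ (P × z ≡ 2ℝ)
    ≤2 : ∀ z → Candidate z → z ≤ 2ℝ
    ≤2 _ (inj₁ refl)      = ≤-trans 0≤1 (subst (_≤ 2ℝ) (+-identityˡ 1ℝ) (+-monoˡ-≤ 1ℝ 0≤1))
    ≤2 _ (inj₂ (_ , refl)) = ≤-refl
    decide : ∃ (λ s → (∀ z → Candidate z → z ≤ s) × (∀ b → (∀ z → Candidate z → z ≤ b) → s ≤ b)) → Dec (¬ P)
    decide (s , upper , least) with total s 1ℝ
    ... | inj₁ s≤1 = yes λ p → 1≰0 (+-cancelʳ-≤ 1ℝ (subst (2ℝ ≤_) (sym (+-identityˡ 1ℝ))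
                                   (≤-trans (upper 2ℝ (inj₂ (p , refl))) s≤1)))
    ... | inj₂ 1≤s = no λ ¬p → 1≰0 (≤-trans 1≤s (least 0ℝ λ { _ (inj₁ refl) → ≤-refl
                                                           ; _ (inj₂ (p , _)) → contradiction p ¬p }))

  record Quadrangle {A B : Set} (N : A → B → ℝ) (i r : A) (j s : B) : Set where
    constructor quadrangle
    field holds : N i s + N r j ≤ N i j + N r s
  open Quadrangle

  module _ {A B : Set} {N : A → B → ℝ} where
    quadrangle-refl-row : ∀ {i j s} → Quadrangle N i i j s
    quadrangle-refl-row {i} {j} {s} = quadrangle (reflexive (+-comm (N i s) (N i j)))

    quadrangle-refl-col : ∀ {i r j} → Quadrangle N i r j j
    quadrangle-refl-col = quadrangle ≤-refl

    quadrangle-swap : ∀ {i r j s} → Quadrangle N i r j s → Quadrangle N r i s j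
    quadrangle-swap {i} {r} {j} {s} (quadrangle q) =
      quadrangle (subst₂ _≤_ (+-comm (N i s) (N r j)) (+-comm (N i j) (N r s)) q)

  symmetrise : ∀ {A : Set} → (A → A → ℝ) → A → A → ℝ
  symmetrise N i j = N i j + N j i

  quadrangle-symmetrise : ∀ {A : Set} {N : A → A → ℝ} {i r j s} →
                          Quadrangle N i r j s → Quadrangle N j s i r → Quadrangle (symmetrise N) i r j s
  quadrangle-symmetrise {N = N} {i} {r} {j} {s} (quadrangle q) (quadrangle q′) =
    quadrangle (subst₂ _≤_ (trans (cong (N i s + N r j +_) (+-comm (N j r) (N s i))) (interchange _ _ _ _))
                           (interchange _ _ _ _)
                  (+-mono-≤ q q′))

  module _ {n : ℕ} (L : Permutation′ n) where
    QuadranglesAlong : (Fin n → Fin n → ℝ) → Set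
    QuadranglesAlong N = ∀ {a b c d} → L ⟨$⟩ˡ a ≤ᶠ L ⟨$⟩ˡ b → L ⟨$⟩ˡ c ≤ᶠ L ⟨$⟩ˡ d → Quadrangle N a b c d

    aMongePermutation⇒quadranglesAlong : ∀ {N} → IsAMongePermutation R L N → QuadranglesAlong N
    aMongePermutation⇒quadranglesAlong {N} monge {a} {b} {c} {d} a≤b c≤d =
      subst₂ (λ a b → Quadrangle N a b c d) (inverseʳ L) (inverseʳ L)
        (subst₂ (Quadrangle N _ _) (inverseʳ L) (inverseʳ L) (atIndices a≤b c≤d))
      where
      atIndices : ∀ {i r j s} → i ≤ᶠ r → j ≤ᶠ s → Quadrangle N (L ⟨$⟩ʳ i) (L ⟨$⟩ʳ r) (L ⟨$⟩ʳ j) (L ⟨$⟩ʳ s)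
      atIndices {i} {r} {j} {s} i≤r j≤s with i Fin.≟ r | j Fin.≟ s
      ... | yes refl | _        = quadrangle-refl-row
      ... | no _     | yes refl = quadrangle-refl-col
      ... | no i≢r   | no j≢s   = quadrangle (monge i r j s (Fin.≤∧≢⇒< i≤r i≢r) (Fin.≤∧≢⇒< j≤s j≢s))

    quadranglesAlong-symmetrise : ∀ {N} → QuadranglesAlong N → QuadranglesAlong (symmetrise N)
    quadranglesAlong-symmetrise q a≤b c≤d = quadrangle-symmetrise (q a≤b c≤d) (q c≤d a≤b)

    orientation : Fin n × Fin n → Bool
    orientation (x , y) = does (L ⟨$⟩ˡ x Fin.≤? L ⟨$⟩ˡ y)

  module _ {n : ℕ} (N : Fin n → Fin n → ℝ) where
    profile : Fin n × Fin n → Fin n → ℝ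
    profile (x , y) a = symmetrise N a y - symmetrise N a x

    profile-≤⇔quadrangle : ∀ x y a b →
      (profile (x , y) a ≤ profile (x , y) b) ⇔ Quadrangle (symmetrise N) a b x y
    profile-≤⇔quadrangle x y a b =
      mk⇔ (quadrangle ∘ Equivalence.to x-y≤u-v⇔x+v≤y+u) (Equivalence.from x-y≤u-v⇔x+v≤y+u ∘ holds)

    profile-swap-≤ : ∀ {x y a b} → profile (y , x) a ≤ profile (y , x) b → profile (x , y) b ≤ profile (x , y) a
    profile-swap-≤ {x} {y} {a} {b} = Equivalence.from (profile-≤⇔quadrangle x y b a)
                                   ∘ quadrangle-swap
                                   ∘ Equivalence.to (profile-≤⇔quadrangle y x a b)

    module _ (L : Permutation′ n) (q : QuadranglesAlong L N) where
      profile-monotone : ∀ {x y} → L ⟨$⟩ˡ x ≤ᶠ L ⟨$⟩ˡ y → MonotoneAlong true L (profile (x , y))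
      profile-monotone {x} {y} x≤y {a} {b} a≤b =
        Equivalence.from (profile-≤⇔quadrangle x y a b) (quadranglesAlong-symmetrise L q a≤b x≤y)

      profile-antitone : ∀ {x y} → L ⟨$⟩ˡ y ≤ᶠ L ⟨$⟩ˡ x → MonotoneAlong false L (profile (x , y))
      profile-antitone y≤x a≤b = profile-swap-≤ (profile-monotone y≤x a≤b)

      profile-oriented : ∀ p → MonotoneAlong (orientation L p) L (profile p)
      profile-oriented (x , y) = oriented (L ⟨$⟩ˡ x Fin.≤? L ⟨$⟩ˡ y)
        where
        oriented : (x≤?y : Dec (L ⟨$⟩ˡ x ≤ᶠ L ⟨$⟩ˡ y)) → MonotoneAlong (does x≤?y) L (profile (x , y))
        oriented (yes x≤y) = profile-monotone x≤y
        oriented (no x≰y)  = profile-antitone (ℕ.≰⇒≥ x≰y)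

      -- With Δ(i,r,j,s) = N i j + N r s - N i s - N r j, the mixed cases rest on the identity
      -- Δ(a,b,c,d) = Δˢ(a,b,x,y) + Δ(b,a,x,c) + Δ(b,a,d,y) + Δ(x,y,b,a), Δˢ being Δ for symmetrise N,
      -- and on its transpose; every term on the right is nonnegative.
      sorted-profile⇒quadrangle : ∀ {x y} → (∀ z → L ⟨$⟩ˡ x ≤ᶠ L ⟨$⟩ˡ z) → (∀ z → L ⟨$⟩ˡ z ≤ᶠ L ⟨$⟩ˡ y) →
        ∀ {a b c d} → profile (x , y) a ≤ profile (x , y) b → profile (x , y) c ≤ profile (x , y) d →
        Quadrangle N a b c d
      sorted-profile⇒quadrangle {x} {y} x-min y-max {a} {b} {c} {d} pa≤pb pc≤pd
        with Fin.≤-total (L ⟨$⟩ˡ a) (L ⟨$⟩ˡ b) | Fin.≤-total (L ⟨$⟩ˡ c) (L ⟨$⟩ˡ d)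
      ... | inj₁ a≤b | inj₁ c≤d = q a≤b c≤d
      ... | inj₂ b≤a | inj₂ d≤c = quadrangle-swap (q b≤a d≤c)
      ... | inj₂ b≤a | inj₁ c≤d = quadrangle (≤-by-balance
        (+-mono-≤ (holds (Equivalence.to (profile-≤⇔quadrangle x y a b) pa≤pb))
          (+-mono-≤ (holds (q b≤a (x-min c))) (+-mono-≤ (holds (q b≤a (y-max d))) (holds (q (x-min y) b≤a)))))
        (solve 12 (λ ad bc ac bd ay ya bx xb ax xa by yb →
            (ad ⊕ bc) ⊕ ((ax ⊕ xa) ⊕ (by ⊕ yb)) ⊕ (bx ⊕ ac) ⊕ (bd ⊕ ay) ⊕ (xb ⊕ ya) ⊜
            (ac ⊕ bd) ⊕ ((ay ⊕ ya) ⊕ (bx ⊕ xb)) ⊕ (bc ⊕ ax) ⊕ (by ⊕ ad) ⊕ (xa ⊕ yb)) refl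
          (N a d) (N b c) (N a c) (N b d) (N a y) (N y a) (N b x) (N x b) (N a x) (N x a) (N b y) (N y b)))
      ... | inj₁ a≤b | inj₂ d≤c = quadrangle (≤-by-balance
        (+-mono-≤ (holds (Equivalence.to (profile-≤⇔quadrangle x y c d) pc≤pd))
          (+-mono-≤ (holds (q (x-min a) d≤c)) (+-mono-≤ (holds (q (y-max b) d≤c)) (holds (q d≤c (x-min y))))))
        (solve 12 (λ ad bc ac bd cy yc dx xd cx xc dy yd →
            (ad ⊕ bc) ⊕ ((cx ⊕ xc) ⊕ (dy ⊕ yd)) ⊕ (xd ⊕ ac) ⊕ (bd ⊕ yc) ⊕ (dx ⊕ cy) ⊜
            (ac ⊕ bd) ⊕ ((cy ⊕ yc) ⊕ (dx ⊕ xd)) ⊕ (xc ⊕ ad) ⊕ (bc ⊕ yd) ⊕ (dy ⊕ cx)) refl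
          (N a d) (N b c) (N a c) (N b d) (N c y) (N y c) (N d x) (N x d) (N c x) (N x c) (N d y) (N y d)))

  module _ {n : ℕ} (L : Permutation′ (ℕ.suc n)) where
    first last : Fin (ℕ.suc n)
    first = L ⟨$⟩ʳ zero
    last  = L ⟨$⟩ʳ fromℕ n

    first-minimal : ∀ z → L ⟨$⟩ˡ first ≤ᶠ L ⟨$⟩ˡ z
    first-minimal z = subst (_≤ᶠ L ⟨$⟩ˡ z) (sym (inverseˡ L)) z≤n

    last-maximal : ∀ z → L ⟨$⟩ˡ z ≤ᶠ L ⟨$⟩ˡ last
    last-maximal z = subst (L ⟨$⟩ˡ z ≤ᶠ_) (sym (inverseˡ L)) (Fin.≤fromℕ _)

    endpoints : Bool → Fin (ℕ.suc n) × Fin (ℕ.suc n)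
    endpoints true  = first , last
    endpoints false = last , first

    module _ {N : Fin (ℕ.suc n) → Fin (ℕ.suc n) → ℝ} (q : QuadranglesAlong L N) where
      profile-endpoints-monotone : ∀ s → MonotoneAlong s L (profile N (endpoints s))
      profile-endpoints-monotone true  = profile-monotone N L q (first-minimal last)
      profile-endpoints-monotone false = profile-antitone N L q (first-minimal last)

      sorted-endpoint-profile⇒quadrangle : ∀ s {a b c d} →
        profile N (endpoints s) a ≤ profile N (endpoints s) b →
        profile N (endpoints s) c ≤ profile N (endpoints s) d → Quadrangle N a b c d
      sorted-endpoint-profile⇒quadrangle true pa≤pb pc≤pd =
        sorted-profile⇒quadrangle N L q first-minimal last-maximal pa≤pb pc≤pd
      sorted-endpoint-profile⇒quadrangle false pa≤pb pc≤pd = quadrangle-swap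
        (sorted-profile⇒quadrangle N L q first-minimal last-maximal
          (profile-swap-≤ N pa≤pb) (profile-swap-≤ N pc≤pd))

  CommonAMongePermutation : ∀ {m n} → (Fin m → Matrix R n) → Subset m → Set
  CommonAMongePermutation {n = n} M U = Σ[ π ∈ Permutation′ n ] (∀ k → k ∈ U → IsAMongePermutation R π (M k))

  any-triple-without-common? : ∀ {m n} (M : Fin m → Matrix R n) →
    Dec (∃ λ i → ∃ λ j → ∃ λ k → ¬ CommonAMongePermutation M (⁅ i ⁆ ∪ ⁅ j ⁆ ∪ ⁅ k ⁆))
  any-triple-without-common? M = Fin.any? λ i → Fin.any? λ j → Fin.any? λ k → weak-excluded-middle _

  module Helly {m n} (M : Fin m → Matrix R (ℕ.suc n))
               (common : ∀ i j k → CommonAMongePermutation M (⁅ i ⁆ ∪ ⁅ j ⁆ ∪ ⁅ k ⁆)) where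
    L : Fin m → Fin m → Fin m → Permutation′ (ℕ.suc n)
    L i j k = proj₁ (common i j k)

    along : ∀ i j k l → l ∈ ⁅ i ⁆ ∪ ⁅ j ⁆ ∪ ⁅ k ⁆ → QuadranglesAlong (L i j k) (M l)
    along i j k l l∈ = aMongePermutation⇒quadranglesAlong (L i j k) (proj₂ (common i j k) l l∈)

    along₁ : ∀ i j k → QuadranglesAlong (L i j k) (M i)
    along₁ i j k = along i j k i (x∈p∪q⁺ (inj₁ (x∈⁅x⁆ i)))

    along₂ : ∀ i j k → QuadranglesAlong (L i j k) (M j)
    along₂ i j k = along i j k j (x∈p∪q⁺ (inj₂ (x∈p∪q⁺ (inj₁ (x∈⁅x⁆ j)))))

    along₃ : ∀ i j k → QuadranglesAlong (L i j k) (M k)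
    along₃ i j k = along i j k k (x∈p∪q⁺ (inj₂ (x∈p∪q⁺ (inj₂ (x∈⁅x⁆ k)))))

    reference : Fin m → Fin (ℕ.suc n) × Fin (ℕ.suc n)
    reference β = endpoints (L β β β) true

    θ : Fin m → Fin (ℕ.suc n) → ℝ
    θ β = profile (M β) (reference β)

    constant-profiles⇒aMonge : (∀ β → Constant (θ β)) → ∀ π k → IsAMongePermutation R π (M k)
    constant-profiles⇒aMonge const π k _ _ _ _ _ _ = holds
      (sorted-endpoint-profile⇒quadrangle (L k k k) (along₁ k k k) true
        (reflexive (const k _ _)) (reflexive (const k _ _)))

    module _ (β : Fin m) (θ-nonconstant : NonConstant (θ β)) where
      orient : Fin m → Bool
      orient k = orientation (L β k k) (reference β)

      χ : Fin m → Fin (ℕ.suc n) → ℝ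
      χ k = profile (M k) (endpoints (L β k k) (orient k))

      θ-χ-comonotone : ∀ k → Comonotone (θ β) (χ k)
      θ-χ-comonotone k = monotoneAlong⇒comonotone {d = orient k} {L = L β k k}
        (profile-oriented (M β) (L β k k) (along₁ β k k) (reference β))
        (profile-endpoints-monotone (L β k k) (along₂ β k k) (orient k))

      χ-comonotone : ∀ j k → Comonotone (χ j) (χ k)
      χ-comonotone j k =
        aligned-or-constant⇒comonotone {d = d} {L = L β j k} (aligned (along₂ β j k)) (aligned (along₃ β j k))
        where
        d : Bool
        d = orientation (L β j k) (reference β)
        aligned : ∀ {l} → QuadranglesAlong (L β j k) (M l) → MonotoneAlong d (L β j k) (χ l) ⊎ Constant (χ l)
        aligned {l} q = aligned-or-constant {d = d} {L = L β j k} θ-nonconstant (θ-χ-comonotone l)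
          (profile-oriented (M β) (L β j k) (along₁ β j k) (reference β)) (profile-oriented (M l) (L β j k) q _)

      sorting : Σ[ π ∈ Permutation′ (ℕ.suc n) ]
                  (∀ {i r} → i ≤ᶠ r → sum (λ k → χ k (π ⟨$⟩ʳ i)) ≤ sum (λ k → χ k (π ⟨$⟩ʳ r)))
      sorting = sortingPermutation (λ a → sum (λ k → χ k a))

      sorting-aMonge : ∀ k → IsAMongePermutation R (proj₁ sorting) (M k)
      sorting-aMonge k _ _ _ _ i<r j<s = holds
        (sorted-endpoint-profile⇒quadrangle (L β k k) (along₂ β k k) (orient k)
          (χ-sorted (ℕ.<⇒≤ i<r)) (χ-sorted (ℕ.<⇒≤ j<s)))
        where
        χ-sorted : ∀ {i r} → i ≤ᶠ r → χ k (proj₁ sorting ⟨$⟩ʳ i) ≤ χ k (proj₁ sorting ⟨$⟩ʳ r)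
        χ-sorted i≤r = comonotone-sum-≤⇒≤ χ χ-comonotone (proj₂ sorting i≤r) k

    -- Constancy of the θ β is only known up to double negation, which suffices as the goal is a negation.
    ¬¬-commonAMongePermutation : ¬ ¬ (Σ[ π ∈ Permutation′ (ℕ.suc n) ] ∀ k → IsAMongePermutation R π (M k))
    ¬¬-commonAMongePermutation none
      with Fin.any? (λ β → Fin.any? λ a → Fin.any? λ b → weak-excluded-middle (θ β a ≡ θ β b))
    ... | yes (β , nonconstant) = none (proj₁ (sorting β nonconstant) , sorting-aMonge β nonconstant)
    ... | no ¬nonconstant = ¬¬-∀ (λ β → ¬¬-∀ λ a → ¬¬-∀ λ b θa≢θb → ¬nonconstant (β , a , b , θa≢θb))
                                λ const → none (id , constant-profiles⇒aMonge const id)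

propositionA6 : (R : RealNumbers) (n m : ℕ) (M : Fin m → Matrix R n) →
    (∀ (π : Permutation′ n) → ¬ (∀ k → IsAMongePermutation R π (M k))) →
    Σ (Subset m) (λ U′ → (∣ U′ ∣ ℕ.≤ 3) ×
      (∀ (π : Permutation′ n) → ¬ (∀ k → k ∈ U′ → IsAMongePermutation R π (M k))))
propositionA6 R ℕ.zero m M noCommon = ⊥-elim (noCommon id λ _ ())
propositionA6 R (ℕ.suc n) m M noCommon with Reals.any-triple-without-common? R M
... | yes (i , j , k , ¬common) = ⁅ i ⁆ ∪ ⁅ j ⁆ ∪ ⁅ k ⁆ , ∣⁅i⁆∪⁅j⁆∪⁅k⁆∣≤3 i j k , curry ¬common
... | no ¬∃ = ⊥-elim (¬¬-∀ (λ i → ¬¬-∀ λ j → ¬¬-∀ λ k ¬common → ¬∃ (i , j , k , ¬common))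
                        λ common → Reals.Helly.¬¬-commonAMongePermutation R M common (uncurry noCommon))
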